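{- Let $k,n$ be positive integers with $k\ge n+1$, $n\ge2$, and let $a,a_1,\ldots,a_{n-1}\in R$. Using the convention that a prefix $z_{k_1,a_1}z_{k_2,a_2-a_1}\cdots z_{k_{i-1},a_{i-1}-a_{i-2}}$ equals $z_{k_1,a_1}$ when $i=2$, the following identities hold in $\mathcal{A}^1$: $$\sum_{\substack{k_1+\cdots+k_{n-1}=k-1\\ k_j\ge1,\,k_1\ge2}}\mathcal{I}^{ -1}(z_{1,a})\ast\mathcal{I}^{ -1}(z_{k_1,a_1}\cdots z_{k_{n-1},a_{n-1}}) =\sum_{\substack{k_1+\cdots+k_{n-1}=k-1\\ k_j\ge1,\,k_1\ge2}}z_{1,a}z_{k_1,a_1}z_{k_2,a_2-a_1}\cdots z_{k_{n-1},a_{n-1}-a_{n-2}}$$ $$+\sum_{i=2}^{n}\sum_{\substack{k_1+\cdots+k_n=k\\ k_j\ge1,\,k_1\ge2,\,k_i=1}}z_{k_1,a_1}\cdots z_{k_{i-1},a_{i-1}-a_{i-2}}\,z_{k_i,a}\,z_{k_{i+1},a_i-a_{i-1}}\cdots z_{k_n,a_{n-1}-a_{n-2}}$$ $$+\sum_{\substack{k_1+\cdots+k_{n-1}=k\\ k_j\ge1,\,k_1\ge3}}z_{k_1,a+a_1}z_{k_2,a_2-a_1}\cdots z_{k_{n-1},a_{n-1}-a_{n-2}}$$ $$+\sum_{i=2}^{n-1}\sum_{\substack{k_1+\cdots+k_{n-1}=k\\ k_j\ge1,\,k_1,k_i\ge2}}z_{k_1,a_1}\cdots z_{k_{i-1},a_{i-1}-a_{i-2}}\,z_{k_i,a+a_i-a_{i-1}}\,z_{k_{i+1},a_{i+1}-a_i}\cdots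 z_{k_{n-1},a_{n-1}-a_{n-2}},$$ and $$\sum_{\substack{l+k_1+\cdots+k_{n-1}=k\\ l,k_j\ge1,\,k_1\ge2}}\mathcal{I}^{ -1}(z_{l,a})\ast\mathcal{I}^{ -1}(z_{k_1,a_1}\cdots z_{k_{n-1},a_{n-1}}) =\sum_{\substack{k_1+\cdots+k_n=k\\ k_j\ge1,\,k_2\ge2}}z_{k_1,a}z_{k_2,a_1}z_{k_3,a_2-a_1}\cdots z_{k_n,a_{n-1}-a_{n-2}}$$ $$+\sum_{i=1}^{n-1}\sum_{\substack{k_1+\cdots+k_n=k\\ k_j\ge1,\,k_1\ge2}}z_{k_1,a_1}z_{k_2,a_2-a_1}\cdots z_{k_i,a_i-a_{i-1}}\,z_{k_{i+1},a}\,z_{k_{i+2},a_{i+1}-a_i}\cdots z_{k_n,a_{n-1}-a_{n-2}}$$ $$+\sum_{\substack{k_1+\cdots+k_{n-1}=k\\ k_j\ge1,\,k_1\ge2}}(k_1-2)\,z_{k_1,a+a_1}z_{k_2,a_2-a_1}\cdots z_{k_{n-1},a_{n-1}-a_{n-2}}$$ $$+\sum_{i=2}^{n-1}\sum_{\substack{k_1+\cdots+k_{n-1}=k\\ k_j\ge1,\,k_1\ge2}}(k_i-1)\,z_{k_1,a_1}z_{k_2,a_2-a_1}\cdots z_{k_{i-1},a_{i-1}-a_{i-2}}\,z_{k_i,a+a_i-a_{i-1}}\,z_{k_{i+1},a_{i+1}-a_i}\cdots z_{k_{n-1},a_{n-1}-a_{n-2}}.$$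
   Context: Fix $N\ge1$, $R=\mathbb{Z}/N\mathbb{Z}$. Let $\mathcal{A}=\mathbb{Q}\langle x,y_a\mid a\in R\rangle$ be the noncommutative polynomial algebra, $\mathcal{A}^1=\mathbb{Q}+\sum_{a\in R}\mathcal{A}y_a$, and $z_{k,a}=x^{k-1}y_a$ for $k\in\mathbb{N}$, $a\in R$. The $\mathbb{Q}$-linear map $\mathcal{I}^{ -1}:\mathcal{A}^1\to\mathcal{A}^1$ is $\mathcal{I}^{ -1}(1)=1$, $\mathcal{I}^{ -1}(z_{k_1,a_1}z_{k_2,a_2}\cdots z_{k_n,a_n})=z_{k_1,a_1}z_{k_2,a_2-a_1}\cdots z_{k_n,a_n-a_{n-1}}$. The harmonic (stuffle) product $\ast$ on $\mathcal{A}^1$ is the $\mathbb{Q}$-bilinear product with $1\ast w=w\ast1=w$ and $z_{k,a}w_1\ast z_{l,b}w_2=z_{k,a}(w_1\ast z_{l,b}w_2)+z_{l,b}(z_{k,a}w_1\ast w_2)+z_{k+l,a+b}(w_1\ast w_2)$ for words $w,w_1,w_2\in\mathcal{A}^1$, $k,l\ge1$, $a,b\in R$. -}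

module Defs where

open import Data.Nat as ℕ using (ℕ; zero; suc; _∸_; _≤ᵇ_; _≡ᵇ_; NonZero)
open import Data.Nat.DivMod using (_mod_)
open import Data.Fin as Fin using (Fin; toℕ)
open import Data.Bool using (Bool; true; false; if_then_else_; _∧_)
open import Data.Product using (_×_; _,_)
open import Data.List using (List; []; _∷_; map; concatMap; zipWith; length)
import Data.List.Properties as LP
open import Data.Integer using (+_)
open import Data.Rational using (ℚ; 0ℚ; 1ℚ) renaming (_+_ to _+ℚ_; _*_ to _*ℚ_; _/_ to _/ℚ_)
open import Relation.Nullary using (yes; no)
open import Relation.Binary.PropositionalEquality using (_≡_)
open import Relation.Binary.Definitions using (DecidableEquality)

-- R = ℤ/Nℤ, represented by Fin N with arithmetic modulo N.

module Alg (N : ℕ) .{{_ : NonZero N}} where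

  R : Set
  R = Fin N

  _+R_ : R → R → R
  a +R b = (toℕ a ℕ.+ toℕ b) mod N

  _-R_ : R → R → R
  a -R b = (toℕ a ℕ.+ (N ∸ toℕ b)) mod N

  -- A letter is stored as (k , a) and
  -- denotes z_{k,a} = x^{k-1} y_a; only k ≥ 1 is ever used below.
  -- 𝒜¹ is spanned over ℚ by the words in the letters z_{k,a}.

  Letter : Set
  Letter = ℕ × R

  Word : Set
  Word = List Letter

  _≟L_ : DecidableEquality Letter
  (k , a) ≟L (l , b) with k ℕ.≟ l | a Fin.≟ b
  ... | yes _≡_.refl | yes _≡_.refl = yes _≡_.refl
  ... | no k≢l | _ = no λ { _≡_.refl → k≢l _≡_.refl }
  ... | yes _ | no a≢b = no λ { _≡_.refl → a≢b _≡_.refl }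

  _≟W_ : DecidableEquality Word
  _≟W_ = LP.≡-dec _≟L_

  -- Elements of 𝒜¹: finite ℚ-linear combinations of words, as formal
  -- lists of (coefficient , word); equality is equality of all
  -- coefficients (i.e. equality in the free ℚ-vector space on words).

  Poly : Set
  Poly = List (ℚ × Word)

  coeff : Word → Poly → ℚ
  coeff w [] = 0ℚ
  coeff w ((c , v) ∷ p) with w ≟W v
  ... | yes _ = c +ℚ coeff w p
  ... | no _  = coeff w p

  _≈_ : Poly → Poly → Set
  p ≈ q = ∀ w → coeff w p ≡ coeff w q

  infix 4 _≈_

  0P : Poly
  0P = []

  word : Word → Poly
  word w = (1ℚ , w) ∷ []

  _⊕_ : Poly → Poly → Poly
  p ⊕ q = p Data.List.++ q

  infixl 6 _⊕_

  _·_ : ℚ → Poly → Poly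
  c · p = map (λ { (d , w) → (c *ℚ d , w) }) p

  lmul : Letter → Poly → Poly
  lmul ℓ p = map (λ { (d , w) → (d , ℓ ∷ w) }) p

  nat : ℕ → ℚ
  nat m = (+ m) /ℚ 1

  Iinv-aux : R → Word → Word
  Iinv-aux prev [] = []
  Iinv-aux prev ((k , a) ∷ w) = (k , a -R prev) ∷ Iinv-aux a w

  Iinv-word : Word → Word
  Iinv-word [] = []
  Iinv-word ((k , a) ∷ w) = (k , a) ∷ Iinv-aux a w

  Iinv : Poly → Poly
  Iinv p = map (λ { (c , w) → (c , Iinv-word w) }) p

  _∗w_ : Word → Word → Poly
  [] ∗w w = word w
  (u ∷ w₁) ∗w [] = word (u ∷ w₁)
  ((k , a) ∷ w₁) ∗w ((l , b) ∷ w₂) =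
        lmul (k , a) (w₁ ∗w ((l , b) ∷ w₂))
      ⊕ lmul (l , b) (((k , a) ∷ w₁) ∗w w₂)
      ⊕ lmul (k ℕ.+ l , a +R b) (w₁ ∗w w₂)

  _∗_ : Poly → Poly → Poly
  p ∗ q = concatMap (λ { (c , v) → concatMap (λ { (d , w) → (c *ℚ d) · (v ∗w w) }) q }) p

  compositions : ℕ → ℕ → List (List ℕ)
  compositions zero zero = [] ∷ []
  compositions zero (suc s) = []
  compositions (suc m) s = concatMap (λ j → map (suc j ∷_) (compositions m (s ∸ suc j))) (Data.List.upTo s)

  Sum : {A : Set} → List A → (A → Bool) → (A → Poly) → Poly
  Sum [] P f = 0P
  Sum (x ∷ xs) P f = (if P x then f x else 0P) ⊕ Sum xs P f

  -- i-th entry, 1-indexed (0 if out of range)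
  at : List ℕ → ℕ → ℕ
  at [] i = 0
  at (k ∷ ks) zero = 0
  at (k ∷ ks) (suc zero) = k
  at (k ∷ ks) (suc (suc i)) = at ks (suc i)

  range : ℕ → ℕ → List ℕ
  range lo hi = Data.List.filter (λ i → lo ℕ.≤? i) (Data.List.upTo (suc hi))

  always : {A : Set} → A → Bool
  always _ = true

  diffs : List R → List R
  diffs [] = []
  diffs (a ∷ as) = a ∷ Iinv-aux' a as
    where
    Iinv-aux' : R → List R → List R
    Iinv-aux' p [] = []
    Iinv-aux' p (b ∷ bs) = (b -R p) ∷ Iinv-aux' b bs

  zw : List ℕ → List R → Word
  zw ks rs = zipWith _,_ ks rs

  -- insert x so that it becomes the i-th entry (1-indexed)
  insertAt : {A : Set} → ℕ → A → List A → List A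
  insertAt zero x xs = x ∷ xs
  insertAt (suc zero) x xs = x ∷ xs
  insertAt (suc (suc i)) x [] = x ∷ []
  insertAt (suc (suc i)) x (y ∷ ys) = y ∷ insertAt (suc i) x ys

  -- add x to the i-th entry (1-indexed)
  addAt : ℕ → R → List R → List R
  addAt i x [] = []
  addAt zero x (y ∷ ys) = y ∷ ys
  addAt (suc zero) x (y ∷ ys) = (x +R y) ∷ ys
  addAt (suc (suc i)) x (y ∷ ys) = y ∷ addAt (suc i) x ys

-- 𝓘⁻¹ of z_{k₁,a₁}⋯z_{k_m,a_m} keeps the exponents and replaces the labels by successive
-- differences, so both identities are sums of stuffles z_{l,a} ∗ w of one letter with a word.
-- Such a stuffle is z_{l,a} w, plus z_{l,a} inserted after each letter of w, plus z_{l,a}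
-- merged into each letter of w.  Summed over the compositions in the statement, each of
-- these four families is reindexed by deleting a part of size 1 or lowering a part of a
-- composition.  In the second identity the free exponent l is absorbed into a part kᵢ,
-- which happens in kᵢ − 1 ways (k₁ − 2 ways for the first part, which must stay ≥ 2):
-- these are the coefficients on the right.

module Submission where

open import Defs
open import Data.Nat as ℕ using (ℕ; zero; suc; _≤_; _<_; _∸_; _≤ᵇ_; _≡ᵇ_; NonZero; z≤n; s≤s)
import Data.Nat.Properties as ℕ
import Data.Nat.Coprimality as Coprime
open import Data.Bool using (Bool; true; false; if_then_else_; _∧_)
open import Data.Product using (_×_; _,_; proj₁)
open import Data.List using (List; []; _∷_; drop; map; concatMap; _++_; applyUpTo; upTo; length)
import Data.List.Properties as List
open import Data.List.Relation.Unary.All as All using (All; []; _∷_)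
import Data.List.Relation.Unary.All.Properties as All
open import Data.Integer as ℤ using (+_)
import Data.Integer.Properties as ℤ
open import Data.Rational using (ℚ; 0ℚ; 1ℚ; mkℚ)
open import Data.Vec using (Vec; toList)
import Data.Vec.Properties as Vec
import Data.Rational as ℚ
import Data.Rational.Properties as ℚ
import Data.Rational.Unnormalised as ℚᵘ
import Data.Rational.Unnormalised.Properties as ℚᵘ
open import Relation.Nullary using (Dec; yes; no; ¬_; contradiction)
open import Relation.Binary.PropositionalEquality
open import Function using (_∘_; id)
open import Algebra.Bundles using (CommutativeMonoid)
open import Algebra.Structures using (IsCommutativeMonoid)
open import Level using (0ℓ)

module _ (N : ℕ) .{{_ : NonZero N}} where
  open Alg N

  coeff-⊕ : ∀ w p q → coeff w (p ⊕ q) ≡ coeff w p ℚ.+ coeff w q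
  coeff-⊕ w [] q = sym (ℚ.+-identityˡ (coeff w q))
  coeff-⊕ w ((c , v) ∷ p) q with w ≟W v
  ... | yes _ = trans (cong (c ℚ.+_) (coeff-⊕ w p q)) (sym (ℚ.+-assoc c (coeff w p) (coeff w q)))
  ... | no _  = coeff-⊕ w p q

  coeff-· : ∀ w c p → coeff w (c · p) ≡ c ℚ.* coeff w p
  coeff-· w c [] = sym (ℚ.*-zeroʳ c)
  coeff-· w c ((d , v) ∷ p) with w ≟W v
  ... | yes _ = trans (cong (c ℚ.* d ℚ.+_) (coeff-· w c p)) (sym (ℚ.*-distribˡ-+ c d (coeff w p)))
  ... | no _  = coeff-· w c p

  coeff-∷-≡ : ∀ {w v} c p → w ≡ v → coeff w ((c , v) ∷ p) ≡ c ℚ.+ coeff w p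
  coeff-∷-≡ {w} {v} c p w≡v with w ≟W v
  ... | yes _   = refl
  ... | no w≢v = contradiction w≡v w≢v

  coeff-∷-≢ : ∀ {w v} c p → ¬ w ≡ v → coeff w ((c , v) ∷ p) ≡ coeff w p
  coeff-∷-≢ {w} {v} c p w≢v with w ≟W v
  ... | yes w≡v = contradiction w≡v w≢v
  ... | no _    = refl

  coeff-lmul : ∀ ℓ w p → coeff (ℓ ∷ w) (lmul ℓ p) ≡ coeff w p
  coeff-lmul ℓ w [] = refl
  coeff-lmul ℓ w ((d , v) ∷ p) = by-cases (w ≟W v)
    where
    by-cases : Dec (w ≡ v) → coeff (ℓ ∷ w) (lmul ℓ ((d , v) ∷ p)) ≡ coeff w ((d , v) ∷ p)
    by-cases (yes w≡v) = trans (coeff-∷-≡ d (lmul ℓ p) (cong (ℓ ∷_) w≡v))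
      (trans (cong (d ℚ.+_) (coeff-lmul ℓ w p)) (sym (coeff-∷-≡ d p w≡v)))
    by-cases (no w≢v) = trans (coeff-∷-≢ d (lmul ℓ p) (w≢v ∘ List.∷-injectiveʳ))
      (trans (coeff-lmul ℓ w p) (sym (coeff-∷-≢ d p w≢v)))

  coeff-lmul-≢ : ∀ {ℓ ℓ′} w p → ¬ ℓ′ ≡ ℓ → coeff (ℓ′ ∷ w) (lmul ℓ p) ≡ 0ℚ
  coeff-lmul-≢ w [] ℓ′≢ℓ = refl
  coeff-lmul-≢ {ℓ} w ((d , v) ∷ p) ℓ′≢ℓ =
    trans (coeff-∷-≢ d (lmul ℓ p) (ℓ′≢ℓ ∘ List.∷-injectiveˡ)) (coeff-lmul-≢ w p ℓ′≢ℓ)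

  coeff-[]-lmul : ∀ ℓ p → coeff [] (lmul ℓ p) ≡ 0ℚ
  coeff-[]-lmul ℓ [] = refl
  coeff-[]-lmul ℓ ((d , v) ∷ p) = trans (coeff-∷-≢ {v = ℓ ∷ v} d (lmul ℓ p) λ ()) (coeff-[]-lmul ℓ p)

  -- A record around _≈_ (a Π-type), so that p and q can be inferred from a proof of p ≋ q.
  infix 4 _≋_
  record _≋_ (p q : Poly) : Set where
    constructor mk
    field get : p ≈ q
  open _≋_ public

  ≋-refl : ∀ {p} → p ≋ p
  ≋-refl = mk λ _ → refl

  ≋-sym : ∀ {p q} → p ≋ q → q ≋ p
  ≋-sym (mk p≈q) = mk λ w → sym (p≈q w)

  ≋-trans : ∀ {p q r} → p ≋ q → q ≋ r → p ≋ r
  ≋-trans (mk p≈q) (mk q≈r) = mk λ w → trans (p≈q w) (q≈r w)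

  ≡⇒≋ : ∀ {p q} → p ≡ q → p ≋ q
  ≡⇒≋ refl = ≋-refl

  ⊕-cong : ∀ {p p′ q q′} → p ≋ p′ → q ≋ q′ → p ⊕ q ≋ p′ ⊕ q′
  ⊕-cong {p} {p′} {q} {q′} (mk p≈p′) (mk q≈q′) = mk λ w →
    trans (coeff-⊕ w p q) (trans (cong₂ ℚ._+_ (p≈p′ w) (q≈q′ w)) (sym (coeff-⊕ w p′ q′)))

  ⊕-comm : ∀ p q → p ⊕ q ≋ q ⊕ p
  ⊕-comm p q = mk λ w →
    trans (coeff-⊕ w p q) (trans (ℚ.+-comm (coeff w p) (coeff w q)) (sym (coeff-⊕ w q p)))

  ⊕-assoc : ∀ p q r → (p ⊕ q) ⊕ r ≋ p ⊕ (q ⊕ r)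
  ⊕-assoc p q r = ≡⇒≋ (List.++-assoc p q r)

  ⊕-identityʳ : ∀ p → p ⊕ 0P ≋ p
  ⊕-identityʳ p = ≡⇒≋ (List.++-identityʳ p)

  ⊕-isCommutativeMonoid : IsCommutativeMonoid _≋_ _⊕_ 0P
  ⊕-isCommutativeMonoid = record
    { isMonoid = record
      { isSemigroup = record
        { isMagma = record
          { isEquivalence = record { refl = ≋-refl ; sym = ≋-sym ; trans = ≋-trans }
          ; ∙-cong = ⊕-cong }
        ; assoc = ⊕-assoc }
      ; identity = (λ _ → ≋-refl) , ⊕-identityʳ }
    ; comm = ⊕-comm }

  ⊕-commutativeMonoid : CommutativeMonoid 0ℓ 0ℓ
  ⊕-commutativeMonoid = record { isCommutativeMonoid = ⊕-isCommutativeMonoid }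

  open import Algebra.Properties.CommutativeSemigroup
    (CommutativeMonoid.commutativeSemigroup ⊕-commutativeMonoid) using (interchange; xy∙z≈x∙zy)
  open import Relation.Binary.Reasoning.Setoid (CommutativeMonoid.setoid ⊕-commutativeMonoid)

  ⊕-congˡ : ∀ {p p′} q → p ≋ p′ → p ⊕ q ≋ p′ ⊕ q
  ⊕-congˡ q p≋p′ = ⊕-cong p≋p′ (≋-refl {q})

  ⊕-congʳ : ∀ p {q q′} → q ≋ q′ → p ⊕ q ≋ p ⊕ q′
  ⊕-congʳ p q≋q′ = ⊕-cong (≋-refl {p}) q≋q′

  lmul-⊕ : ∀ ℓ p q → lmul ℓ (p ⊕ q) ≡ lmul ℓ p ⊕ lmul ℓ q
  lmul-⊕ ℓ p q = List.map-++ _ p q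

  lmul-cong : ∀ ℓ {p q} → p ≋ q → lmul ℓ p ≋ lmul ℓ q
  lmul-cong ℓ {p} {q} (mk p≈q) = mk coeffs
    where
    coeffs : ∀ w → coeff w (lmul ℓ p) ≡ coeff w (lmul ℓ q)
    coeffs [] = trans (coeff-[]-lmul ℓ p) (sym (coeff-[]-lmul ℓ q))
    coeffs (ℓ′ ∷ w) with ℓ′ ≟L ℓ
    ... | yes refl  = trans (coeff-lmul ℓ w p) (trans (p≈q w) (sym (coeff-lmul ℓ w q)))
    ... | no ℓ′≢ℓ = trans (coeff-lmul-≢ w p ℓ′≢ℓ) (sym (coeff-lmul-≢ w q ℓ′≢ℓ))

  ·-zeroˡ : ∀ p → 0ℚ · p ≋ 0P
  ·-zeroˡ p = mk λ w → trans (coeff-· w 0ℚ p) (ℚ.*-zeroˡ (coeff w p))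

  ·-identityˡ : ∀ p → 1ℚ · p ≋ p
  ·-identityˡ p = mk λ w → trans (coeff-· w 1ℚ p) (ℚ.*-identityˡ (coeff w p))

  ·-distribʳ-+ : ∀ c d p → (c ℚ.+ d) · p ≋ c · p ⊕ d · p
  ·-distribʳ-+ c d p = mk λ w → trans (coeff-· w (c ℚ.+ d) p)
    (trans (ℚ.*-distribʳ-+ (coeff w p) c d)
      (sym (trans (coeff-⊕ w (c · p) (d · p)) (cong₂ ℚ._+_ (coeff-· w c p) (coeff-· w d p)))))

  -- nat m is a normalised fraction m / 1; its reduced form is the literal mkℚ (+ m) 0.
  nat-suc : ∀ m → nat (suc m) ≡ 1ℚ ℚ.+ nat m
  nat-suc m = trans (nat≡mkℚ (suc m)) (trans
    (ℚ.toℚᵘ-injective (ℚᵘ.≃-trans (ℚᵘ.*≡* m+1≡1+m) (ℚᵘ.≃-sym (ℚ.toℚᵘ-homo-+ 1ℚ (mkℚ (+ m) 0 (n⊥1 m))))))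
    (cong (1ℚ ℚ.+_) (sym (nat≡mkℚ m))))
    where
    n⊥1 : ∀ n → Coprime.Coprime n 1
    n⊥1 n = Coprime.sym (Coprime.1-coprimeTo n)
    nat≡mkℚ : ∀ n → nat n ≡ mkℚ (+ n) 0 (n⊥1 n)
    nat≡mkℚ n = ℚ.normalize-coprime (n⊥1 n)
    m+1≡1+m : + suc m ℤ.* + 1 ≡ (+ 1 ℤ.* + 1 ℤ.+ + m ℤ.* + 1) ℤ.* + 1
    m+1≡1+m = trans (ℤ.*-identityʳ (+ suc m))
      (sym (trans (ℤ.*-identityʳ _) (cong (λ x → + 1 ℤ.+ x) (ℤ.*-identityʳ (+ m)))))

  nat-suc-· : ∀ m p → nat (suc m) · p ≋ p ⊕ nat m · p
  nat-suc-· m p = begin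
    nat (suc m) · p       ≡⟨ cong (_· p) (nat-suc m) ⟩
    (1ℚ ℚ.+ nat m) · p    ≈⟨ ·-distribʳ-+ 1ℚ (nat m) p ⟩
    1ℚ · p ⊕ nat m · p    ≈⟨ ⊕-congˡ (nat m · p) (·-identityˡ p) ⟩
    p ⊕ nat m · p         ∎

  ∗-word : ∀ u v → word u ∗ word v ≋ u ∗w v
  ∗-word u v = ≋-trans (≡⇒≋ (trans (List.++-identityʳ _) (List.++-identityʳ _))) (·-identityˡ (u ∗w v))

  ∑ : {A : Set} → List A → (A → Poly) → Poly
  ∑ xs f = Sum xs always f

  when : Bool → Poly → Poly
  when b p = if b then p else 0P

  Sum-as-∑ : {A : Set} (xs : List A) (P : A → Bool) (f : A → Poly) →
             Sum xs P f ≡ ∑ xs (λ x → when (P x) (f x))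
  Sum-as-∑ []       P f = refl
  Sum-as-∑ (x ∷ xs) P f = cong (when (P x) (f x) ⊕_) (Sum-as-∑ xs P f)

  when-∧ : ∀ b c p → when (b ∧ c) p ≡ when c (when b p)
  when-∧ true  c     p = refl
  when-∧ false true  p = refl
  when-∧ false false p = refl

  Sum-∧ : {A : Set} (xs : List A) (P Q : A → Bool) (f : A → Poly) →
          Sum xs (λ x → P x ∧ Q x) f ≡ ∑ xs (λ x → when (Q x) (when (P x) (f x)))
  Sum-∧ []       P Q f = refl
  Sum-∧ (x ∷ xs) P Q f = cong₂ _⊕_ (when-∧ (P x) (Q x) (f x)) (Sum-∧ xs P Q f)

  when-cong : ∀ b {p q} → p ≋ q → when b p ≋ when b q
  when-cong true  p≋q = p≋q
  when-cong false p≋q = ≋-refl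

  when-· : ∀ b c p → when b (c · p) ≡ c · when b p
  when-· true  c p = refl
  when-· false c p = refl

  ∑-cong : {A : Set} (xs : List A) {f g : A → Poly} → (∀ x → f x ≋ g x) → ∑ xs f ≋ ∑ xs g
  ∑-cong []       f≋g = ≋-refl
  ∑-cong (x ∷ xs) f≋g = ⊕-cong (f≋g x) (∑-cong xs f≋g)

  ∑-cong-All : {A : Set} {Q : A → Set} (xs : List A) {f g : A → Poly} →
               All Q xs → (∀ x → Q x → f x ≋ g x) → ∑ xs f ≋ ∑ xs g
  ∑-cong-All []       []         f≋g = ≋-refl
  ∑-cong-All (x ∷ xs) (qx ∷ qxs) f≋g = ⊕-cong (f≋g x qx) (∑-cong-All xs qxs f≋g)

  ∑-cong≡ : {A : Set} (xs : List A) {f g : A → Poly} → (∀ x → f x ≡ g x) → ∑ xs f ≡ ∑ xs g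
  ∑-cong≡ []       f≡g = refl
  ∑-cong≡ (x ∷ xs) f≡g = cong₂ _⊕_ (f≡g x) (∑-cong≡ xs f≡g)

  ∑-zero : {A : Set} (xs : List A) (f : A → Poly) → (∀ x → f x ≋ 0P) → ∑ xs f ≋ 0P
  ∑-zero []       f f≋0 = ≋-refl
  ∑-zero (x ∷ xs) f f≋0 = ⊕-cong (f≋0 x) (∑-zero xs f f≋0)

  ∑-zero-All : {A : Set} {Q : A → Set} (xs : List A) (f : A → Poly) →
               All Q xs → (∀ x → Q x → f x ≋ 0P) → ∑ xs f ≋ 0P
  ∑-zero-All xs f qxs f≋0 = ≋-trans (∑-cong-All xs qxs f≋0) (∑-zero xs (λ _ → 0P) λ _ → ≋-refl)

  ∑-⊕ : {A : Set} (xs : List A) (f g : A → Poly) → ∑ xs (λ x → f x ⊕ g x) ≋ ∑ xs f ⊕ ∑ xs g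
  ∑-⊕ []       f g = ≋-refl
  ∑-⊕ (x ∷ xs) f g = ≋-trans (⊕-congʳ (f x ⊕ g x) (∑-⊕ xs f g)) (interchange (f x) (g x) (∑ xs f) (∑ xs g))

  ∑-⊕⁴ : {A : Set} (xs : List A) (f g h e : A → Poly) →
         ∑ xs (λ x → f x ⊕ g x ⊕ (h x ⊕ e x)) ≋ ∑ xs f ⊕ ∑ xs g ⊕ (∑ xs h ⊕ ∑ xs e)
  ∑-⊕⁴ xs f g h e = ≋-trans (∑-⊕ xs (λ x → f x ⊕ g x) (λ x → h x ⊕ e x)) (⊕-cong (∑-⊕ xs f g) (∑-⊕ xs h e))

  ∑-++ : {A : Set} (xs ys : List A) (f : A → Poly) → ∑ (xs ++ ys) f ≋ ∑ xs f ⊕ ∑ ys f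
  ∑-++ []       ys f = ≋-refl
  ∑-++ (x ∷ xs) ys f = ≋-trans (⊕-congʳ (f x) (∑-++ xs ys f)) (≋-sym (⊕-assoc (f x) (∑ xs f) (∑ ys f)))

  ∑-map : {A B : Set} (h : A → B) (xs : List A) (f : B → Poly) → ∑ (map h xs) f ≡ ∑ xs (f ∘ h)
  ∑-map h []       f = refl
  ∑-map h (x ∷ xs) f = cong (f (h x) ⊕_) (∑-map h xs f)

  ∑-concatMap : {A B : Set} (h : A → List B) (xs : List A) (f : B → Poly) →
                ∑ (concatMap h xs) f ≋ ∑ xs (λ x → ∑ (h x) f)
  ∑-concatMap h []       f = ≋-refl
  ∑-concatMap h (x ∷ xs) f = ≋-trans (∑-++ (h x) (concatMap h xs) f) (⊕-congʳ (∑ (h x) f) (∑-concatMap h xs f))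

  ∑-swap : {A B : Set} (xs : List A) (ys : List B) (f : A → B → Poly) →
           ∑ xs (λ x → ∑ ys (f x)) ≋ ∑ ys (λ y → ∑ xs (λ x → f x y))
  ∑-swap []       ys f = ≋-sym (∑-zero ys _ λ _ → ≋-refl)
  ∑-swap (x ∷ xs) ys f = ≋-trans (⊕-congʳ (∑ ys (f x)) (∑-swap xs ys f))
                                 (≋-sym (∑-⊕ ys (f x) (λ y → ∑ xs (λ x′ → f x′ y))))

  ∑-lmul : {A : Set} (ℓ : Letter) (xs : List A) (f : A → Poly) → lmul ℓ (∑ xs f) ≡ ∑ xs (lmul ℓ ∘ f)
  ∑-lmul ℓ []       f = refl
  ∑-lmul ℓ (x ∷ xs) f = trans (lmul-⊕ ℓ (f x) (∑ xs f)) (cong (lmul ℓ (f x) ⊕_) (∑-lmul ℓ xs f))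

  ∑-applyUpTo : (h : ℕ → ℕ) (n : ℕ) (f : ℕ → Poly) → ∑ (applyUpTo h n) f ≡ ∑ (upTo n) (f ∘ h)
  ∑-applyUpTo h n f = trans (cong (λ xs → ∑ xs f) (sym (List.map-applyUpTo id h n))) (∑-map h (upTo n) f)

  ∑-upTo-suc : (n : ℕ) (f : ℕ → Poly) → ∑ (upTo (suc n)) f ≡ f 0 ⊕ ∑ (upTo n) (f ∘ suc)
  ∑-upTo-suc n f = cong (f 0 ⊕_) (∑-applyUpTo suc n f)

  upTo-< : ∀ n → All (_< n) (upTo n)
  upTo-< n = All.applyUpTo⁺₁ id n id

  ∑-range-from-1 : ∀ n (f : ℕ → Poly) → Sum (range 1 n) always f ≡ ∑ (upTo n) (f ∘ suc)
  ∑-range-from-1 n f = trans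
    (cong (λ xs → ∑ xs f) (List.filter-all (1 ℕ.≤?_) (All.applyUpTo⁺₁ suc n λ _ → s≤s z≤n)))
    (∑-applyUpTo suc n f)

  ∑-range-from-2 : ∀ n (f : ℕ → Poly) → Sum (range 2 (suc n)) always f ≡ ∑ (upTo n) (f ∘ suc ∘ suc)
  ∑-range-from-2 n f = trans
    (cong (λ xs → ∑ xs f) (List.filter-all (2 ℕ.≤?_) (All.applyUpTo⁺₁ (suc ∘ suc) n λ _ → s≤s (s≤s z≤n))))
    (∑-applyUpTo (suc ∘ suc) n f)

  plusAt : ℕ → ℕ → List ℕ → List ℕ
  plusAt i             x []       = []
  plusAt zero          x (y ∷ ys) = y ∷ ys
  plusAt (suc zero)    x (y ∷ ys) = x ℕ.+ y ∷ ys
  plusAt (suc (suc i)) x (y ∷ ys) = y ∷ plusAt (suc i) x ys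

  PositiveParts : ℕ → List ℕ → Set
  PositiveParts m ks = length ks ≡ m × All (1 ≤_) ks

  compositions-positive : ∀ m s → All (PositiveParts m) (compositions m s)
  compositions-positive zero    zero    = (refl , []) ∷ []
  compositions-positive zero    (suc s) = []
  compositions-positive (suc m) s       = All.concat⁺ (All.map⁺ (All.applyUpTo⁺₂ _ s λ j →
    All.map⁺ (All.map (λ (len , pos) → cong suc len , s≤s z≤n ∷ pos) (compositions-positive m (s ∸ suc j)))))

  compositions-suc : ∀ m s → compositions (suc m) (suc s)
                           ≡ map (1 ∷_) (compositions m s) ++ map (plusAt 1 1) (compositions (suc m) s)
  compositions-suc m s = cong (map (1 ∷_) (compositions m s) ++_) (shifted id s)
    where
    startingWith : ℕ → ℕ → List (List ℕ)
    startingWith t j = map (suc j ∷_) (compositions m (t ∸ suc j))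
    shifted : ∀ (g : ℕ → ℕ) n → concatMap (startingWith (suc s)) (applyUpTo (suc ∘ g) n)
                              ≡ map (plusAt 1 1) (concatMap (startingWith s) (applyUpTo g n))
    shifted g zero    = refl
    shifted g (suc n) = trans
      (cong₂ _++_ (List.map-∘ (compositions m (s ∸ suc (g 0)))) (shifted (g ∘ suc) n))
      (sym (List.map-++ (plusAt 1 1) (startingWith s (g 0)) (concatMap (startingWith s) (applyUpTo (g ∘ suc) n))))

  ∑-compositions-suc : ∀ m s (f : List ℕ → Poly) →
    ∑ (compositions (suc m) (suc s)) f ≋ ∑ (compositions m s) (f ∘ (1 ∷_)) ⊕ ∑ (compositions (suc m) s) (f ∘ plusAt 1 1)
  ∑-compositions-suc m s f rewrite compositions-suc m s = ≋-trans
    (∑-++ (map (1 ∷_) (compositions m s)) _ f)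
    (≡⇒≋ (cong₂ _⊕_ (∑-map (1 ∷_) (compositions m s) f) (∑-map (plusAt 1 1) (compositions (suc m) s) f)))

  ∑-compositions-by-head : ∀ m s (f : List ℕ → Poly) →
    ∑ (compositions (suc m) s) f ≋ ∑ (upTo s) (λ j → ∑ (compositions m (s ∸ suc j)) (f ∘ (suc j ∷_)))
  ∑-compositions-by-head m s f = ≋-trans (∑-concatMap _ (upTo s) f)
    (∑-cong (upTo s) λ j → ≡⇒≋ (∑-map (suc j ∷_) (compositions m (s ∸ suc j)) f))

  at-plusAt-1-1 : ∀ i ks → at (plusAt 1 1 ks) (suc (suc i)) ≡ at ks (suc (suc i))
  at-plusAt-1-1 i []       = refl
  at-plusAt-1-1 i (y ∷ ys) = refl

  at-plusAt-head : ∀ i x ks → at (plusAt (suc (suc i)) x ks) 1 ≡ at ks 1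
  at-plusAt-head i x []       = refl
  at-plusAt-head i x (y ∷ ys) = refl

  at-plusAt : ∀ i x ks → 1 ≤ i → i ≤ length ks → at (plusAt i x ks) i ≡ x ℕ.+ at ks i
  at-plusAt (suc zero)    x (y ∷ ys) _ _       = refl
  at-plusAt (suc (suc i)) x (y ∷ ys) _ (s≤s i≤) = at-plusAt (suc i) x ys (s≤s z≤n) i≤

  at-positive : ∀ i ks → 1 ≤ i → i ≤ length ks → All (1 ≤_) ks → 1 ≤ at ks i
  at-positive (suc zero)    (y ∷ ys) _ _        (1≤y ∷ _)  = 1≤y
  at-positive (suc (suc i)) (y ∷ ys) _ (s≤s i≤) (_ ∷ pos) = at-positive (suc i) ys (s≤s z≤n) i≤ pos

  plusAt-insertAt : ∀ i x ks → 1 ≤ i → i ≤ suc (length ks) → plusAt i 1 (insertAt i x ks) ≡ insertAt i (suc x) ks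
  plusAt-insertAt (suc zero)    x ks       _ _        = refl
  plusAt-insertAt (suc (suc i)) x []       _ (s≤s ())
  plusAt-insertAt (suc (suc i)) x (y ∷ ys) _ (s≤s i≤) = cong (y ∷_) (plusAt-insertAt (suc i) x ys (s≤s z≤n) i≤)

  plusAt-suc : ∀ i x ks → plusAt i (suc x) ks ≡ plusAt i 1 (plusAt i x ks)
  plusAt-suc i             x []       = refl
  plusAt-suc zero          x (y ∷ ys) = refl
  plusAt-suc (suc zero)    x (y ∷ ys) = refl
  plusAt-suc (suc (suc i)) x (y ∷ ys) = cong (y ∷_) (plusAt-suc (suc i) x ys)

  plusAt-1-1-comm : ∀ i x ks → plusAt 1 1 (plusAt (suc (suc i)) x ks) ≡ plusAt (suc (suc i)) x (plusAt 1 1 ks)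
  plusAt-1-1-comm i x []       = refl
  plusAt-1-1-comm i x (y ∷ ys) = refl

  when-split : ∀ x → 1 ≤ x → ∀ p → p ≋ when (x ≡ᵇ 1) p ⊕ when (2 ≤ᵇ x) p
  when-split (suc zero)    _ p = ≋-sym (⊕-identityʳ p)
  when-split (suc (suc x)) _ p = ≋-refl

  ∑-compositions-part≥2 : ∀ s m i → 1 ≤ i → i ≤ m → (f : List ℕ → Poly) →
    ∑ (compositions m (suc s)) (λ ks → when (2 ≤ᵇ at ks i) (f ks)) ≋ ∑ (compositions m s) (f ∘ plusAt i 1)
  ∑-compositions-part≥2 s zero (suc i) _ ()
  ∑-compositions-part≥2 s (suc m) (suc zero) _ _ f = ≋-trans (∑-compositions-suc m s _)
    (⊕-cong (∑-zero (compositions m s) _ λ _ → ≋-refl)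
            (∑-cong-All (compositions (suc m) s) (compositions-positive (suc m) s) raised))
    where
    raised : ∀ ks → PositiveParts (suc m) ks → when (2 ≤ᵇ at (plusAt 1 1 ks) 1) (f (plusAt 1 1 ks)) ≋ f (plusAt 1 1 ks)
    raised (suc y ∷ ys) _             = ≋-refl
    raised (zero  ∷ ys) (_ , (() ∷ _))
  ∑-compositions-part≥2 zero    (suc (suc m)) (suc (suc i)) _ (s≤s i≤) f = ≋-refl
  ∑-compositions-part≥2 (suc s) (suc (suc m)) (suc (suc i)) _ (s≤s i≤) f = begin
      ∑ (compositions (suc (suc m)) (suc (suc s))) (λ ks → when (2 ≤ᵇ at ks i+2) (f ks))
    ≈⟨ ∑-compositions-suc (suc m) (suc s) _ ⟩
      ∑ (compositions (suc m) (suc s)) (λ ks → when (2 ≤ᵇ at ks (suc i)) (f (1 ∷ ks)))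
      ⊕ ∑ (compositions (suc (suc m)) (suc s)) (λ ks → when (2 ≤ᵇ at (plusAt 1 1 ks) i+2) (f (plusAt 1 1 ks)))
    ≈⟨ ⊕-cong (∑-compositions-part≥2 s (suc m) (suc i) (s≤s z≤n) i≤ (f ∘ (1 ∷_)))
              (≋-trans (∑-cong (compositions (suc (suc m)) (suc s)) λ ks →
                          ≡⇒≋ (cong (λ y → when (2 ≤ᵇ y) (f (plusAt 1 1 ks))) (at-plusAt-1-1 i ks)))
                       (∑-compositions-part≥2 s (suc (suc m)) i+2 (s≤s z≤n) (s≤s i≤) (f ∘ plusAt 1 1))) ⟩
      ∑ (compositions (suc m) s) (λ ks → f (1 ∷ plusAt (suc i) 1 ks))
      ⊕ ∑ (compositions (suc (suc m)) s) (λ ks → f (plusAt 1 1 (plusAt i+2 1 ks)))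
    ≈⟨ ⊕-congʳ _ (∑-cong (compositions (suc (suc m)) s) λ ks → ≡⇒≋ (cong f (plusAt-1-1-comm i 1 ks))) ⟩
      ∑ (compositions (suc m) s) (λ ks → f (plusAt i+2 1 (1 ∷ ks)))
      ⊕ ∑ (compositions (suc (suc m)) s) (λ ks → f (plusAt i+2 1 (plusAt 1 1 ks)))
    ≈⟨ ∑-compositions-suc (suc m) s (f ∘ plusAt i+2 1) ⟨
      ∑ (compositions (suc (suc m)) (suc s)) (f ∘ plusAt i+2 1) ∎
    where i+2 = suc (suc i)

  ∑-compositions-part≡1 : ∀ s m i → 1 ≤ i → i ≤ suc m → (f : List ℕ → Poly) →
    ∑ (compositions (suc m) (suc s)) (λ ks → when (at ks i ≡ᵇ 1) (f ks)) ≋ ∑ (compositions m s) (f ∘ insertAt i 1)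
  ∑-compositions-part≡1 s m (suc zero) _ _ f = ≋-trans (∑-compositions-suc m s _)
    (≋-trans (⊕-congʳ _ (∑-zero-All (compositions (suc m) s) _ (compositions-positive (suc m) s) raised))
             (⊕-identityʳ _))
    where
    raised : ∀ ks → PositiveParts (suc m) ks → when (at (plusAt 1 1 ks) 1 ≡ᵇ 1) (f (plusAt 1 1 ks)) ≋ 0P
    raised (suc y ∷ ys) _             = ≋-refl
    raised (zero  ∷ ys) (_ , (() ∷ _))
  ∑-compositions-part≡1 s       zero    (suc (suc i)) _ (s≤s ())
  ∑-compositions-part≡1 zero    (suc m) (suc (suc i)) _ (s≤s i≤) f = ≋-refl
  ∑-compositions-part≡1 (suc s) (suc m) (suc (suc i)) _ (s≤s i≤) f = begin
      ∑ (compositions (suc (suc m)) (suc (suc s))) (λ ks → when (at ks i+2 ≡ᵇ 1) (f ks))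
    ≈⟨ ∑-compositions-suc (suc m) (suc s) _ ⟩
      ∑ (compositions (suc m) (suc s)) (λ ks → when (at ks (suc i) ≡ᵇ 1) (f (1 ∷ ks)))
      ⊕ ∑ (compositions (suc (suc m)) (suc s)) (λ ks → when (at (plusAt 1 1 ks) i+2 ≡ᵇ 1) (f (plusAt 1 1 ks)))
    ≈⟨ ⊕-cong (∑-compositions-part≡1 s m (suc i) (s≤s z≤n) i≤ (f ∘ (1 ∷_)))
              (≋-trans (∑-cong (compositions (suc (suc m)) (suc s)) λ ks →
                          ≡⇒≋ (cong (λ y → when (y ≡ᵇ 1) (f (plusAt 1 1 ks))) (at-plusAt-1-1 i ks)))
                       (∑-compositions-part≡1 s (suc m) i+2 (s≤s z≤n) (s≤s i≤) (f ∘ plusAt 1 1))) ⟩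
      ∑ (compositions m s) (λ ks → f (1 ∷ insertAt (suc i) 1 ks))
      ⊕ ∑ (compositions (suc m) s) (λ ks → f (plusAt 1 1 (insertAt i+2 1 ks)))
    ≈⟨ ⊕-congʳ _ (∑-cong-All (compositions (suc m) s) (compositions-positive (suc m) s) commute) ⟩
      ∑ (compositions m s) (λ ks → f (insertAt i+2 1 (1 ∷ ks)))
      ⊕ ∑ (compositions (suc m) s) (λ ks → f (insertAt i+2 1 (plusAt 1 1 ks)))
    ≈⟨ ∑-compositions-suc m s (f ∘ insertAt i+2 1) ⟨
      ∑ (compositions (suc m) (suc s)) (f ∘ insertAt i+2 1) ∎
    where
    i+2 = suc (suc i)
    commute : ∀ ks → PositiveParts (suc m) ks → f (plusAt 1 1 (insertAt i+2 1 ks)) ≋ f (insertAt i+2 1 (plusAt 1 1 ks))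
    commute (y ∷ ys) _ = ≋-refl

  ∑-compositions-by-part : ∀ k m i → 1 ≤ i → i ≤ suc m → (f : List ℕ → Poly) →
    ∑ (compositions (suc m) k) f ≋ ∑ (upTo k) (λ j → ∑ (compositions m (k ∸ suc j)) (f ∘ insertAt i (suc j)))
  ∑-compositions-by-part zero    m i 1≤i i≤ f = ≋-refl
  ∑-compositions-by-part (suc k) m i 1≤i i≤ f = begin
      ∑ (compositions (suc m) (suc k)) f
    ≈⟨ ∑-cong-All (compositions (suc m) (suc k)) (compositions-positive (suc m) (suc k)) (λ ks (len , pos) →
         when-split (at ks i) (at-positive i ks 1≤i (subst (i ≤_) (sym len) i≤) pos) (f ks)) ⟩
      ∑ (compositions (suc m) (suc k)) (λ ks → when (at ks i ≡ᵇ 1) (f ks) ⊕ when (2 ≤ᵇ at ks i) (f ks))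
    ≈⟨ ∑-⊕ (compositions (suc m) (suc k)) _ _ ⟩
      ∑ (compositions (suc m) (suc k)) (λ ks → when (at ks i ≡ᵇ 1) (f ks))
      ⊕ ∑ (compositions (suc m) (suc k)) (λ ks → when (2 ≤ᵇ at ks i) (f ks))
    ≈⟨ ⊕-cong (∑-compositions-part≡1 k m i 1≤i i≤ f) (∑-compositions-part≥2 k (suc m) i 1≤i i≤ f) ⟩
      ∑ (compositions m k) (f ∘ insertAt i 1) ⊕ ∑ (compositions (suc m) k) (f ∘ plusAt i 1)
    ≈⟨ ⊕-congʳ _ (∑-compositions-by-part k m i 1≤i i≤ (f ∘ plusAt i 1)) ⟩
      ∑ (compositions m k) (f ∘ insertAt i 1)
      ⊕ ∑ (upTo k) (λ j → ∑ (compositions m (k ∸ suc j)) (f ∘ plusAt i 1 ∘ insertAt i (suc j)))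
    ≈⟨ ⊕-congʳ _ (∑-cong (upTo k) λ j → ∑-cong-All (compositions m (k ∸ suc j)) (compositions-positive m (k ∸ suc j))
         λ ks (len , _) → ≡⇒≋ (cong f (plusAt-insertAt i (suc j) ks 1≤i (subst (λ l → i ≤ suc l) (sym len) i≤)))) ⟩
      ∑ (compositions m k) (f ∘ insertAt i 1)
      ⊕ ∑ (upTo k) (λ j → ∑ (compositions m (k ∸ suc j)) (f ∘ insertAt i (suc (suc j))))
    ≡⟨ ∑-upTo-suc k (λ j → ∑ (compositions m (suc k ∸ suc j)) (f ∘ insertAt i (suc j))) ⟨
      ∑ (upTo (suc k)) (λ j → ∑ (compositions m (suc k ∸ suc j)) (f ∘ insertAt i (suc j))) ∎

  weight-at-1 : ∀ c x p → when (x ≡ᵇ 1) (nat (x ∸ suc c) · p) ≋ 0P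
  weight-at-1 c zero          p = ≋-refl
  weight-at-1 c (suc zero)    p rewrite ℕ.0∸n≡0 c = ·-zeroˡ p
  weight-at-1 c (suc (suc x)) p = ≋-refl

  weight-step : ∀ c x p → when (suc c ≤ᵇ x) p ⊕ nat (x ∸ suc c) · p ≋ nat (x ∸ c) · p
  weight-step zero    zero    p = ≋-refl
  weight-step zero    (suc x) p = ≋-sym (nat-suc-· x p)
  weight-step (suc c) zero    p = ≋-refl
  weight-step (suc c) (suc x) p = weight-step c x p

  -- The weight ksᵢ ∸ (c + 1) vanishes when ksᵢ = 1, so only compositions with ksᵢ ≥ 2 contribute.
  ∑-compositions-weighted-suc : ∀ k m i c → 1 ≤ i → i ≤ m → (f : List ℕ → Poly) →
    ∑ (compositions m (suc k)) (λ ks → nat (at ks i ∸ suc c) · f ks)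
    ≋ ∑ (compositions m k) (λ ks → nat (at ks i ∸ c) · f (plusAt i 1 ks))
  ∑-compositions-weighted-suc k m i c 1≤i i≤m f = begin
      ∑ (compositions m (suc k)) g
    ≈⟨ ∑-cong-All (compositions m (suc k)) (compositions-positive m (suc k)) (λ ks (len , pos) →
         when-split (at ks i) (at-positive i ks 1≤i (subst (i ≤_) (sym len) i≤m) pos) (g ks)) ⟩
      ∑ (compositions m (suc k)) (λ ks → when (at ks i ≡ᵇ 1) (g ks) ⊕ when (2 ≤ᵇ at ks i) (g ks))
    ≈⟨ ∑-⊕ (compositions m (suc k)) _ _ ⟩
      ∑ (compositions m (suc k)) (λ ks → when (at ks i ≡ᵇ 1) (g ks))
      ⊕ ∑ (compositions m (suc k)) (λ ks → when (2 ≤ᵇ at ks i) (g ks))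
    ≈⟨ ⊕-congˡ _ (∑-zero (compositions m (suc k)) _ λ ks → weight-at-1 c (at ks i) (f ks)) ⟩
      ∑ (compositions m (suc k)) (λ ks → when (2 ≤ᵇ at ks i) (g ks))
    ≈⟨ ∑-compositions-part≥2 k m i 1≤i i≤m g ⟩
      ∑ (compositions m k) (g ∘ plusAt i 1)
    ≈⟨ ∑-cong-All (compositions m k) (compositions-positive m k) (λ ks (len , _) →
         ≡⇒≋ (cong (λ y → nat (y ∸ suc c) · f (plusAt i 1 ks)) (at-plusAt i 1 ks 1≤i (subst (i ≤_) (sym len) i≤m)))) ⟩
      ∑ (compositions m k) (λ ks → nat (at ks i ∸ c) · f (plusAt i 1 ks)) ∎
    where
    g : List ℕ → Poly
    g ks = nat (at ks i ∸ suc c) · f ks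

  -- A composition ks arises as plusAt i (j + 1) ks′ with ks′ᵢ > c in exactly ksᵢ ∸ (c + 1) ways.
  ∑-compositions-weighted : ∀ k m i c → 1 ≤ i → i ≤ m → (f : List ℕ → Poly) →
    ∑ (upTo k) (λ j → ∑ (compositions m (k ∸ suc j)) (λ ks → when (suc c ≤ᵇ at ks i) (f (plusAt i (suc j) ks))))
    ≋ ∑ (compositions m k) (λ ks → nat (at ks i ∸ suc c) · f ks)
  ∑-compositions-weighted k       zero    (suc i) c _ () f
  ∑-compositions-weighted zero    (suc m) i       c _ _  f = ≋-refl
  ∑-compositions-weighted (suc k) (suc m) i c 1≤i i≤m f = begin
      ∑ (upTo (suc k)) (λ j → ∑ (compositions (suc m) (suc k ∸ suc j)) (λ ks → when (suc c ≤ᵇ at ks i) (f (plusAt i (suc j) ks))))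
    ≡⟨ ∑-upTo-suc k _ ⟩
      ∑ (compositions (suc m) k) (λ ks → when (suc c ≤ᵇ at ks i) (f (plusAt i 1 ks)))
      ⊕ ∑ (upTo k) (λ j → ∑ (compositions (suc m) (k ∸ suc j)) (λ ks → when (suc c ≤ᵇ at ks i) (f (plusAt i (suc (suc j)) ks))))
    ≈⟨ ⊕-congʳ _ (≋-trans
         (∑-cong (upTo k) λ j → ∑-cong (compositions (suc m) (k ∸ suc j)) λ ks →
            ≡⇒≋ (cong (λ ks′ → when (suc c ≤ᵇ at ks i) (f ks′)) (plusAt-suc i (suc j) ks)))
         (∑-compositions-weighted k (suc m) i c 1≤i i≤m (f ∘ plusAt i 1))) ⟩
      ∑ (compositions (suc m) k) (λ ks → when (suc c ≤ᵇ at ks i) (f (plusAt i 1 ks)))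
      ⊕ ∑ (compositions (suc m) k) (λ ks → nat (at ks i ∸ suc c) · f (plusAt i 1 ks))
    ≈⟨ ∑-⊕ (compositions (suc m) k) _ _ ⟨
      ∑ (compositions (suc m) k) (λ ks → when (suc c ≤ᵇ at ks i) (f (plusAt i 1 ks)) ⊕ nat (at ks i ∸ suc c) · f (plusAt i 1 ks))
    ≈⟨ ∑-cong (compositions (suc m) k) (λ ks → weight-step c (at ks i) (f (plusAt i 1 ks))) ⟩
      ∑ (compositions (suc m) k) (λ ks → nat (at ks i ∸ c) · f (plusAt i 1 ks))
    ≈⟨ ∑-compositions-weighted-suc k (suc m) i c 1≤i i≤m f ⟨
      ∑ (compositions (suc m) (suc k)) (λ ks → nat (at ks i ∸ suc c) · f ks) ∎

  mergeAt : ℕ → Letter → Word → Word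
  mergeAt i             ℓ       []            = []
  mergeAt zero          ℓ       (u ∷ v)       = u ∷ v
  mergeAt (suc zero)    (l , b) ((k , c) ∷ v) = (l ℕ.+ k , b +R c) ∷ v
  mergeAt (suc (suc i)) ℓ       (u ∷ v)       = u ∷ mergeAt (suc i) ℓ v

  insertions : Letter → Word → Poly
  insertions ℓ v = ∑ (upTo (length v)) (λ j → word (insertAt (suc (suc j)) ℓ v))

  merges : Letter → Word → Poly
  merges ℓ v = ∑ (upTo (length v)) (λ j → word (mergeAt (suc j) ℓ v))

  insertions-∷ : ∀ ℓ u v → insertions ℓ (u ∷ v) ≡ word (u ∷ ℓ ∷ v) ⊕ lmul u (insertions ℓ v)
  insertions-∷ ℓ u v = trans (∑-upTo-suc (length v) λ j → word (insertAt (suc (suc j)) ℓ (u ∷ v)))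
                             (cong (word (u ∷ ℓ ∷ v) ⊕_) (sym (∑-lmul u (upTo (length v)) _)))

  merges-∷ : ∀ l b k c v →
             merges (l , b) ((k , c) ∷ v) ≡ word ((l ℕ.+ k , b +R c) ∷ v) ⊕ lmul (k , c) (merges (l , b) v)
  merges-∷ l b k c v = trans (∑-upTo-suc (length v) λ j → word (mergeAt (suc j) (l , b) ((k , c) ∷ v)))
                             (cong (word ((l ℕ.+ k , b +R c) ∷ v) ⊕_) (sym (∑-lmul (k , c) (upTo (length v)) _)))

  letter-∗w : ∀ ℓ v → (ℓ ∷ []) ∗w v ≋ word (ℓ ∷ v) ⊕ insertions ℓ v ⊕ merges ℓ v
  letter-∗w ℓ [] = ≋-sym (≋-trans (⊕-identityʳ _) (⊕-identityʳ _))
  letter-∗w ℓ@(l , b) (u@(k , c) ∷ v) = begin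
      word (ℓ ∷ u ∷ v) ⊕ lmul u ((ℓ ∷ []) ∗w v) ⊕ merged
    ≈⟨ ⊕-congˡ merged (⊕-congʳ (word (ℓ ∷ u ∷ v)) (lmul-cong u (letter-∗w ℓ v))) ⟩
      word (ℓ ∷ u ∷ v) ⊕ lmul u (word (ℓ ∷ v) ⊕ I ⊕ M) ⊕ merged
    ≡⟨ cong (λ p → word (ℓ ∷ u ∷ v) ⊕ p ⊕ merged)
         (trans (lmul-⊕ u (word (ℓ ∷ v) ⊕ I) M) (cong (_⊕ lmul u M) (lmul-⊕ u (word (ℓ ∷ v)) I))) ⟩
      word (ℓ ∷ u ∷ v) ⊕ (word (u ∷ ℓ ∷ v) ⊕ lmul u I ⊕ lmul u M) ⊕ merged
    ≈⟨ ≋-trans (⊕-congˡ merged (≋-sym (⊕-assoc (word (ℓ ∷ u ∷ v)) (word (u ∷ ℓ ∷ v) ⊕ lmul u I) (lmul u M))))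
               (xy∙z≈x∙zy (word (ℓ ∷ u ∷ v) ⊕ (word (u ∷ ℓ ∷ v) ⊕ lmul u I)) (lmul u M) merged) ⟩
      word (ℓ ∷ u ∷ v) ⊕ (word (u ∷ ℓ ∷ v) ⊕ lmul u I) ⊕ (merged ⊕ lmul u M)
    ≡⟨ cong₂ (λ p q → word (ℓ ∷ u ∷ v) ⊕ p ⊕ q) (insertions-∷ ℓ u v) (merges-∷ l b k c v) ⟨
      word (ℓ ∷ u ∷ v) ⊕ insertions ℓ (u ∷ v) ⊕ merges ℓ (u ∷ v) ∎
    where
    merged = word ((l ℕ.+ k , b +R c) ∷ v)
    I = insertions ℓ v
    M = merges ℓ v

  length-zw : ∀ (ks : List ℕ) (rs : List R) → length ks ≡ length rs → length (zw ks rs) ≡ length ks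
  length-zw []       []       _   = refl
  length-zw (k ∷ ks) (r ∷ rs) len = cong suc (length-zw ks rs (ℕ.suc-injective len))

  zw-insertAt : ∀ i (x : ℕ) (y : R) (ks : List ℕ) (rs : List R) → length ks ≡ length rs →
                zw (insertAt i x ks) (insertAt i y rs) ≡ insertAt i (x , y) (zw ks rs)
  zw-insertAt zero          x y ks       rs       _   = refl
  zw-insertAt (suc zero)    x y ks       rs       _   = refl
  zw-insertAt (suc (suc i)) x y []       []       _   = refl
  zw-insertAt (suc (suc i)) x y (k ∷ ks) (r ∷ rs) len = cong ((k , r) ∷_) (zw-insertAt (suc i) x y ks rs (ℕ.suc-injective len))

  mergeAt-zw : ∀ i (l : ℕ) (a : R) (ks : List ℕ) (rs : List R) → mergeAt i (l , a) (zw ks rs) ≡ zw (plusAt i l ks) (addAt i a rs)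
  mergeAt-zw i             l a []       rs       = refl
  mergeAt-zw zero          l a (k ∷ ks) []       = refl
  mergeAt-zw (suc zero)    l a (k ∷ ks) []       = refl
  mergeAt-zw (suc (suc i)) l a (k ∷ ks) []       = refl
  mergeAt-zw zero          l a (k ∷ ks) (r ∷ rs) = refl
  mergeAt-zw (suc zero)    l a (k ∷ ks) (r ∷ rs) = refl
  mergeAt-zw (suc (suc i)) l a (k ∷ ks) (r ∷ rs) = cong ((k , r) ∷_) (mergeAt-zw (suc i) l a ks rs)

  letter-∗w-zw : ∀ m (l : ℕ) (a : R) (ks : List ℕ) (rs : List R) → length ks ≡ suc m → length rs ≡ suc m →
    ((l , a) ∷ []) ∗w zw ks rs
    ≋ word ((l , a) ∷ zw ks rs)
      ⊕ ∑ (upTo (suc m)) (λ j → word (zw (insertAt (suc (suc j)) l ks) (insertAt (suc (suc j)) a rs)))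
      ⊕ (word (zw (plusAt 1 l ks) (addAt 1 a rs))
         ⊕ ∑ (upTo m) (λ j → word (zw (plusAt (suc (suc j)) l ks) (addAt (suc (suc j)) a rs))))
  letter-∗w-zw m l a ks rs len-ks len-rs = begin
      ((l , a) ∷ []) ∗w zw ks rs
    ≈⟨ letter-∗w (l , a) (zw ks rs) ⟩
      word ((l , a) ∷ zw ks rs) ⊕ insertions (l , a) (zw ks rs) ⊕ merges (l , a) (zw ks rs)
    ≡⟨ cong (λ n → word ((l , a) ∷ zw ks rs)
                   ⊕ ∑ (upTo n) (λ j → word (insertAt (suc (suc j)) (l , a) (zw ks rs)))
                   ⊕ ∑ (upTo n) (λ j → word (mergeAt (suc j) (l , a) (zw ks rs)))) len-zw ⟩
      word ((l , a) ∷ zw ks rs)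
      ⊕ ∑ (upTo (suc m)) (λ j → word (insertAt (suc (suc j)) (l , a) (zw ks rs)))
      ⊕ ∑ (upTo (suc m)) (λ j → word (mergeAt (suc j) (l , a) (zw ks rs)))
    ≡⟨ cong₂ (λ p q → word ((l , a) ∷ zw ks rs) ⊕ p ⊕ q)
         (∑-cong≡ (upTo (suc m)) λ j → cong word (sym (zw-insertAt (suc (suc j)) l a ks rs (trans len-ks (sym len-rs)))))
         (trans (∑-upTo-suc m (λ j → word (mergeAt (suc j) (l , a) (zw ks rs))))
                (cong₂ _⊕_ (cong word (mergeAt-zw 1 l a ks rs))
                           (∑-cong≡ (upTo m) λ j → cong word (mergeAt-zw (suc (suc j)) l a ks rs)))) ⟩
      word ((l , a) ∷ zw ks rs)
      ⊕ ∑ (upTo (suc m)) (λ j → word (zw (insertAt (suc (suc j)) l ks) (insertAt (suc (suc j)) a rs)))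
      ⊕ (word (zw (plusAt 1 l ks) (addAt 1 a rs))
         ⊕ ∑ (upTo m) (λ j → word (zw (plusAt (suc (suc j)) l ks) (addAt (suc (suc j)) a rs)))) ∎
    where
    len-zw : length (zw ks rs) ≡ suc m
    len-zw = trans (length-zw ks rs (trans len-ks (sym len-rs))) len-ks

  Iinv-aux-zw : ∀ (r : R) (ks : List ℕ) (rs : List R) → Iinv-aux r (zw ks rs) ≡ zw ks (drop 1 (diffs (r ∷ rs)))
  Iinv-aux-zw r []       rs        = refl
  Iinv-aux-zw r (k ∷ ks) []        = refl
  Iinv-aux-zw r (k ∷ ks) (r′ ∷ rs) = cong ((k , r′ -R r) ∷_) (Iinv-aux-zw r′ ks rs)

  Iinv-word-zw : ∀ (ks : List ℕ) (rs : List R) → Iinv-word (zw ks rs) ≡ zw ks (diffs rs)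
  Iinv-word-zw []       rs       = refl
  Iinv-word-zw (k ∷ ks) []       = refl
  Iinv-word-zw (k ∷ ks) (r ∷ rs) = cong ((k , r) ∷_) (Iinv-aux-zw r ks rs)

  length-diffs : ∀ (rs : List R) → length (diffs rs) ≡ length rs
  length-diffs []       = refl
  length-diffs (r ∷ rs) = cong suc (length-tail r rs)
    where
    length-tail : ∀ r rs → length (drop 1 (diffs (r ∷ rs))) ≡ length rs
    length-tail r []        = refl
    length-tail r (r′ ∷ rs) = cong suc (length-tail r′ rs)

  Iinv-letter-∗-Iinv-zw : ∀ l a ks rs → Iinv (word ((l , a) ∷ [])) ∗ Iinv (word (zw ks rs)) ≋ ((l , a) ∷ []) ∗w zw ks (diffs rs)
  Iinv-letter-∗-Iinv-zw l a ks rs = ≋-trans (∗-word ((l , a) ∷ []) (Iinv-word (zw ks rs)))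
                                            (≡⇒≋ (cong (((l , a) ∷ []) ∗w_) (Iinv-word-zw ks rs)))

  admissible : List ℕ → Bool
  admissible ks = 2 ≤ᵇ at ks 1

  compositions-length : ∀ m s → All (λ ks → length ks ≡ m) (compositions m s)
  compositions-length m s = All.map proj₁ (compositions-positive m s)

  ∑-admissible-Iinv-∗ : ∀ m (l : ℕ) (a : R) (ws : List R) (xss : List (List ℕ)) →
    length ws ≡ suc m → All (λ ks → length ks ≡ suc m) xss →
    let ds = diffs ws in
    ∑ xss (λ ks → when (admissible ks) (Iinv (word ((l , a) ∷ [])) ∗ Iinv (word (zw ks ws))))
    ≋ ∑ xss (λ ks → when (admissible ks) (word ((l , a) ∷ zw ks ds)))
      ⊕ ∑ (upTo (suc m)) (λ j → ∑ xss (λ ks → when (admissible ks)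
          (word (zw (insertAt (suc (suc j)) l ks) (insertAt (suc (suc j)) a ds)))))
      ⊕ (∑ xss (λ ks → when (admissible ks) (word (zw (plusAt 1 l ks) (addAt 1 a ds))))
         ⊕ ∑ (upTo m) (λ j → ∑ xss (λ ks → when (admissible ks)
             (word (zw (plusAt (suc (suc j)) l ks) (addAt (suc (suc j)) a ds))))))
  ∑-admissible-Iinv-∗ m l a ws xss len-ws len-xss = begin
      ∑ xss (λ ks → when (admissible ks) (Iinv (word ((l , a) ∷ [])) ∗ Iinv (word (zw ks ws))))
    ≈⟨ ∑-cong-All xss len-xss (λ ks len → when-cong (admissible ks)
         (≋-trans (Iinv-letter-∗-Iinv-zw l a ks ws) (letter-∗w-zw m l a ks ds len (trans (length-diffs ws) len-ws)))) ⟩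
      ∑ xss (λ ks → when (admissible ks) (prepend ks ⊕ ∑ (upTo (suc m)) (insert ks) ⊕ (mergeFirst ks ⊕ ∑ (upTo m) (merge ks))))
    ≈⟨ ∑-cong xss (λ ks → distribute (admissible ks) (prepend ks) (insert ks) (mergeFirst ks) (merge ks)) ⟩
      ∑ xss (λ ks → when (admissible ks) (prepend ks) ⊕ ∑ (upTo (suc m)) (when (admissible ks) ∘ insert ks)
                    ⊕ (when (admissible ks) (mergeFirst ks) ⊕ ∑ (upTo m) (when (admissible ks) ∘ merge ks)))
    ≈⟨ ∑-⊕⁴ xss _ _ _ _ ⟩
      ∑ xss (λ ks → when (admissible ks) (prepend ks))
      ⊕ ∑ xss (λ ks → ∑ (upTo (suc m)) (when (admissible ks) ∘ insert ks))
      ⊕ (∑ xss (λ ks → when (admissible ks) (mergeFirst ks))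
         ⊕ ∑ xss (λ ks → ∑ (upTo m) (when (admissible ks) ∘ merge ks)))
    ≈⟨ ⊕-cong (⊕-congʳ (∑ xss (λ ks → when (admissible ks) (prepend ks))) (∑-swap xss (upTo (suc m)) _))
              (⊕-congʳ (∑ xss (λ ks → when (admissible ks) (mergeFirst ks))) (∑-swap xss (upTo m) _)) ⟩
      ∑ xss (λ ks → when (admissible ks) (prepend ks))
      ⊕ ∑ (upTo (suc m)) (λ j → ∑ xss (λ ks → when (admissible ks) (insert ks j)))
      ⊕ (∑ xss (λ ks → when (admissible ks) (mergeFirst ks))
         ⊕ ∑ (upTo m) (λ j → ∑ xss (λ ks → when (admissible ks) (merge ks j)))) ∎
    where
    ds = diffs ws
    prepend mergeFirst : List ℕ → Poly
    prepend ks    = word ((l , a) ∷ zw ks ds)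
    mergeFirst ks = word (zw (plusAt 1 l ks) (addAt 1 a ds))
    insert merge : List ℕ → ℕ → Poly
    insert ks j = word (zw (insertAt (suc (suc j)) l ks) (insertAt (suc (suc j)) a ds))
    merge ks j  = word (zw (plusAt (suc (suc j)) l ks) (addAt (suc (suc j)) a ds))
    distribute : ∀ b p (f : ℕ → Poly) q (g : ℕ → Poly) →
      when b (p ⊕ ∑ (upTo (suc m)) f ⊕ (q ⊕ ∑ (upTo m) g))
      ≋ when b p ⊕ ∑ (upTo (suc m)) (when b ∘ f) ⊕ (when b q ⊕ ∑ (upTo m) (when b ∘ g))
    distribute true  p f q g = ≋-refl
    distribute false p f q g = ≋-sym (⊕-cong (∑-zero (upTo (suc m)) _ λ _ → ≋-refl) (∑-zero (upTo m) _ λ _ → ≋-refl))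

  ∑-inserted-ones : ∀ m s (g : ℕ → List ℕ → Poly) →
    ∑ (upTo (suc m)) (λ j → ∑ (compositions (suc m) s) (λ ks →
        when (admissible ks) (g (suc (suc j)) (insertAt (suc (suc j)) 1 ks))))
    ≋ Sum (range 2 (suc (suc m))) always (λ i →
        Sum (compositions (suc (suc m)) (suc s)) (λ ks → (2 ≤ᵇ at ks 1) ∧ (at ks i ≡ᵇ 1)) (g i))
  ∑-inserted-ones m s g = ≋-sym (≋-trans (≡⇒≋ (∑-range-from-2 (suc m) _)) (∑-cong-All (upTo (suc m)) (upTo-< (suc m)) at-part))
    where
    at-part : ∀ j → j < suc m →
      Sum (compositions (suc (suc m)) (suc s)) (λ ks → (2 ≤ᵇ at ks 1) ∧ (at ks (suc (suc j)) ≡ᵇ 1)) (g (suc (suc j)))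
      ≋ ∑ (compositions (suc m) s) (λ ks → when (admissible ks) (g (suc (suc j)) (insertAt (suc (suc j)) 1 ks)))
    at-part j j<m+1 = begin
        Sum (compositions (suc (suc m)) (suc s)) (λ ks → admissible ks ∧ (at ks i ≡ᵇ 1)) (g i)
      ≡⟨ Sum-∧ (compositions (suc (suc m)) (suc s)) admissible (λ ks → at ks i ≡ᵇ 1) (g i) ⟩
        ∑ (compositions (suc (suc m)) (suc s)) (λ ks → when (at ks i ≡ᵇ 1) (when (admissible ks) (g i ks)))
      ≈⟨ ∑-compositions-part≡1 s (suc m) i (s≤s z≤n) (s≤s j<m+1) (λ ks → when (admissible ks) (g i ks)) ⟩
        ∑ (compositions (suc m) s) (λ ks → when (admissible (insertAt i 1 ks)) (g i (insertAt i 1 ks)))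
      ≈⟨ ∑-cong-All (compositions (suc m) s) (compositions-length (suc m) s) (λ { (_ ∷ _) _ → ≋-refl }) ⟩
        ∑ (compositions (suc m) s) (λ ks → when (admissible ks) (g i (insertAt i 1 ks))) ∎
      where i = suc (suc j)

  ∑-raised-first : ∀ m s (g : List ℕ → Poly) →
    ∑ (compositions (suc m) s) (λ ks → when (admissible ks) (g (plusAt 1 1 ks)))
    ≋ Sum (compositions (suc m) (suc s)) (λ ks → 3 ≤ᵇ at ks 1) g
  ∑-raised-first m s g = ≋-sym (begin
      Sum (compositions (suc m) (suc s)) (λ ks → 3 ≤ᵇ at ks 1) g
    ≡⟨ Sum-as-∑ (compositions (suc m) (suc s)) (λ ks → 3 ≤ᵇ at ks 1) g ⟩
      ∑ (compositions (suc m) (suc s)) (λ ks → when (3 ≤ᵇ at ks 1) (g ks))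
    ≡⟨ ∑-cong≡ (compositions (suc m) (suc s)) (λ ks → ≥3⇒≥2 (at ks 1) (g ks)) ⟩
      ∑ (compositions (suc m) (suc s)) (λ ks → when (2 ≤ᵇ at ks 1) (when (3 ≤ᵇ at ks 1) (g ks)))
    ≈⟨ ∑-compositions-part≥2 s (suc m) 1 (s≤s z≤n) (s≤s z≤n) (λ ks → when (3 ≤ᵇ at ks 1) (g ks)) ⟩
      ∑ (compositions (suc m) s) (λ ks → when (3 ≤ᵇ at (plusAt 1 1 ks) 1) (g (plusAt 1 1 ks)))
    ≈⟨ ∑-cong (compositions (suc m) s) (λ { [] → ≋-refl ; (_ ∷ _) → ≋-refl }) ⟩
      ∑ (compositions (suc m) s) (λ ks → when (admissible ks) (g (plusAt 1 1 ks))) ∎)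
    where
    ≥3⇒≥2 : ∀ x p → when (3 ≤ᵇ x) p ≡ when (2 ≤ᵇ x) (when (3 ≤ᵇ x) p)
    ≥3⇒≥2 zero          p = refl
    ≥3⇒≥2 (suc zero)    p = refl
    ≥3⇒≥2 (suc (suc x)) p = refl

  ∑-raised-parts : ∀ m s (g : ℕ → List ℕ → Poly) →
    ∑ (upTo m) (λ j → ∑ (compositions (suc m) s) (λ ks →
        when (admissible ks) (g (suc (suc j)) (plusAt (suc (suc j)) 1 ks))))
    ≋ Sum (range 2 (suc m)) always (λ i →
        Sum (compositions (suc m) (suc s)) (λ ks → (2 ≤ᵇ at ks 1) ∧ (2 ≤ᵇ at ks i)) (g i))
  ∑-raised-parts m s g = ≋-sym (≋-trans (≡⇒≋ (∑-range-from-2 m _)) (∑-cong-All (upTo m) (upTo-< m) at-part))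
    where
    at-part : ∀ j → j < m →
      Sum (compositions (suc m) (suc s)) (λ ks → (2 ≤ᵇ at ks 1) ∧ (2 ≤ᵇ at ks (suc (suc j)))) (g (suc (suc j)))
      ≋ ∑ (compositions (suc m) s) (λ ks → when (admissible ks) (g (suc (suc j)) (plusAt (suc (suc j)) 1 ks)))
    at-part j j<m = begin
        Sum (compositions (suc m) (suc s)) (λ ks → admissible ks ∧ (2 ≤ᵇ at ks i)) (g i)
      ≡⟨ Sum-∧ (compositions (suc m) (suc s)) admissible (λ ks → 2 ≤ᵇ at ks i) (g i) ⟩
        ∑ (compositions (suc m) (suc s)) (λ ks → when (2 ≤ᵇ at ks i) (when (admissible ks) (g i ks)))
      ≈⟨ ∑-compositions-part≥2 s (suc m) i (s≤s z≤n) (s≤s j<m) (λ ks → when (admissible ks) (g i ks)) ⟩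
        ∑ (compositions (suc m) s) (λ ks → when (admissible (plusAt i 1 ks)) (g i (plusAt i 1 ks)))
      ≡⟨ ∑-cong≡ (compositions (suc m) s) (λ ks → cong (λ y → when (2 ≤ᵇ y) (g i (plusAt i 1 ks))) (at-plusAt-head j 1 ks)) ⟩
        ∑ (compositions (suc m) s) (λ ks → when (admissible ks) (g i (plusAt i 1 ks))) ∎
      where i = suc (suc j)

  first-identity : ∀ m s (a : R) (ws : List R) → length ws ≡ suc m →
    let ds = diffs ws in
    Sum (compositions (suc m) s) (λ ks → 2 ≤ᵇ at ks 1)
        (λ ks → Iinv (word ((1 , a) ∷ [])) ∗ Iinv (word (zw ks ws)))
    ≋ Sum (compositions (suc m) s) (λ ks → 2 ≤ᵇ at ks 1)
          (λ ks → word ((1 , a) ∷ zw ks ds))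
    ⊕ Sum (range 2 (suc (suc m))) always (λ i →
        Sum (compositions (suc (suc m)) (suc s)) (λ ks → (2 ≤ᵇ at ks 1) ∧ (at ks i ≡ᵇ 1))
          (λ ks → word (zw ks (insertAt i a ds))))
    ⊕ Sum (compositions (suc m) (suc s)) (λ ks → 3 ≤ᵇ at ks 1)
          (λ ks → word (zw ks (addAt 1 a ds)))
    ⊕ Sum (range 2 (suc m)) always (λ i →
        Sum (compositions (suc m) (suc s)) (λ ks → (2 ≤ᵇ at ks 1) ∧ (2 ≤ᵇ at ks i))
          (λ ks → word (zw ks (addAt i a ds))))
  first-identity m s a ws len = begin
      Sum (compositions (suc m) s) admissible (λ ks → Iinv (word ((1 , a) ∷ [])) ∗ Iinv (word (zw ks ws)))
    ≡⟨ Sum-as-∑ (compositions (suc m) s) admissible _ ⟩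
      ∑ (compositions (suc m) s) (λ ks → when (admissible ks) (Iinv (word ((1 , a) ∷ [])) ∗ Iinv (word (zw ks ws))))
    ≈⟨ ≋-trans (∑-admissible-Iinv-∗ m 1 a ws (compositions (suc m) s) len (compositions-length (suc m) s))
        (⊕-cong (⊕-cong (≡⇒≋ (sym (Sum-as-∑ (compositions (suc m) s) admissible _)))
                        (∑-inserted-ones m s λ i ks → word (zw ks (insertAt i a ds))))
                (⊕-cong (∑-raised-first m s λ ks → word (zw ks (addAt 1 a ds)))
                        (∑-raised-parts m s λ i ks → word (zw ks (addAt i a ds))))) ⟩
      T₁ ⊕ T₂ ⊕ (T₃ ⊕ T₄)
    ≈⟨ ⊕-assoc (T₁ ⊕ T₂) T₃ T₄ ⟨
      T₁ ⊕ T₂ ⊕ T₃ ⊕ T₄ ∎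
    where
    ds = diffs ws
    T₁ T₂ T₃ T₄ : Poly
    T₁ = Sum (compositions (suc m) s) admissible (λ ks → word ((1 , a) ∷ zw ks ds))
    T₂ = Sum (range 2 (suc (suc m))) always (λ i →
           Sum (compositions (suc (suc m)) (suc s)) (λ ks → (2 ≤ᵇ at ks 1) ∧ (at ks i ≡ᵇ 1))
             (λ ks → word (zw ks (insertAt i a ds))))
    T₃ = Sum (compositions (suc m) (suc s)) (λ ks → 3 ≤ᵇ at ks 1) (λ ks → word (zw ks (addAt 1 a ds)))
    T₄ = Sum (range 2 (suc m)) always (λ i →
           Sum (compositions (suc m) (suc s)) (λ ks → (2 ≤ᵇ at ks 1) ∧ (2 ≤ᵇ at ks i))
             (λ ks → word (zw ks (addAt i a ds))))

  ∑-leading-part : ∀ m k (g : List ℕ → Poly) →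
    ∑ (upTo k) (λ t → ∑ (compositions m (k ∸ suc t)) (λ ks → when (admissible ks) (g (suc t ∷ ks))))
    ≋ Sum (compositions (suc m) k) (λ ks → 2 ≤ᵇ at ks 2) g
  ∑-leading-part m k g = ≋-sym (≋-trans (≡⇒≋ (Sum-as-∑ (compositions (suc m) k) (λ ks → 2 ≤ᵇ at ks 2) g))
                                        (∑-compositions-by-head m k _))

  ∑-inserted-parts : ∀ m k (g : ℕ → List ℕ → Poly) →
    ∑ (upTo (suc m)) (λ j → ∑ (upTo k) (λ t → ∑ (compositions (suc m) (k ∸ suc t)) (λ ks →
        when (admissible ks) (g (suc (suc j)) (insertAt (suc (suc j)) (suc t) ks)))))
    ≋ Sum (range 1 (suc m)) always (λ i →
        Sum (compositions (suc (suc m)) k) (λ ks → 2 ≤ᵇ at ks 1) (g (suc i)))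
  ∑-inserted-parts m k g = ≋-sym (≋-trans (≡⇒≋ (∑-range-from-1 (suc m) _)) (∑-cong-All (upTo (suc m)) (upTo-< (suc m)) at-part))
    where
    at-part : ∀ j → j < suc m →
      Sum (compositions (suc (suc m)) k) admissible (g (suc (suc j)))
      ≋ ∑ (upTo k) (λ t → ∑ (compositions (suc m) (k ∸ suc t)) (λ ks →
          when (admissible ks) (g (suc (suc j)) (insertAt (suc (suc j)) (suc t) ks))))
    at-part j j<m+1 = begin
        Sum (compositions (suc (suc m)) k) admissible (g i)
      ≡⟨ Sum-as-∑ (compositions (suc (suc m)) k) admissible (g i) ⟩
        ∑ (compositions (suc (suc m)) k) (λ ks → when (admissible ks) (g i ks))
      ≈⟨ ∑-compositions-by-part k (suc m) i (s≤s z≤n) (s≤s j<m+1) _ ⟩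
        ∑ (upTo k) (λ t → ∑ (compositions (suc m) (k ∸ suc t)) (λ ks →
          when (admissible (insertAt i (suc t) ks)) (g i (insertAt i (suc t) ks))))
      ≈⟨ ∑-cong (upTo k) (λ t → ∑-cong-All (compositions (suc m) (k ∸ suc t)) (compositions-length (suc m) (k ∸ suc t))
           λ { (_ ∷ _) _ → ≋-refl }) ⟩
        ∑ (upTo k) (λ t → ∑ (compositions (suc m) (k ∸ suc t)) (λ ks →
          when (admissible ks) (g i (insertAt i (suc t) ks)))) ∎
      where i = suc (suc j)

  when-≥2-weight : ∀ x p → when (2 ≤ᵇ x) (nat (x ∸ 2) · p) ≋ nat (x ∸ 2) · p
  when-≥2-weight zero          p = ≋-sym (·-zeroˡ p)
  when-≥2-weight (suc zero)    p = ≋-sym (·-zeroˡ p)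
  when-≥2-weight (suc (suc x)) p = ≋-refl

  ∑-weighted-first : ∀ m k (g : List ℕ → Poly) →
    ∑ (upTo k) (λ t → ∑ (compositions (suc m) (k ∸ suc t)) (λ ks → when (admissible ks) (g (plusAt 1 (suc t) ks))))
    ≋ Sum (compositions (suc m) k) (λ ks → 2 ≤ᵇ at ks 1) (λ ks → nat (at ks 1 ∸ 2) · g ks)
  ∑-weighted-first m k g = begin
      ∑ (upTo k) (λ t → ∑ (compositions (suc m) (k ∸ suc t)) (λ ks → when (admissible ks) (g (plusAt 1 (suc t) ks))))
    ≈⟨ ∑-compositions-weighted k (suc m) 1 1 (s≤s z≤n) (s≤s z≤n) g ⟩
      ∑ (compositions (suc m) k) (λ ks → nat (at ks 1 ∸ 2) · g ks)
    ≈⟨ ∑-cong (compositions (suc m) k) (λ ks → when-≥2-weight (at ks 1) (g ks)) ⟨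
      ∑ (compositions (suc m) k) (λ ks → when (admissible ks) (nat (at ks 1 ∸ 2) · g ks))
    ≡⟨ Sum-as-∑ (compositions (suc m) k) admissible (λ ks → nat (at ks 1 ∸ 2) · g ks) ⟨
      Sum (compositions (suc m) k) admissible (λ ks → nat (at ks 1 ∸ 2) · g ks) ∎

  ∑-weighted-parts : ∀ m k (g : ℕ → List ℕ → Poly) →
    ∑ (upTo m) (λ j → ∑ (upTo k) (λ t → ∑ (compositions (suc m) (k ∸ suc t)) (λ ks →
        when (admissible ks) (g (suc (suc j)) (plusAt (suc (suc j)) (suc t) ks)))))
    ≋ Sum (range 2 (suc m)) always (λ i →
        Sum (compositions (suc m) k) (λ ks → 2 ≤ᵇ at ks 1) (λ ks → nat (at ks i ∸ 1) · g i ks))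
  ∑-weighted-parts m k g = ≋-sym (≋-trans (≡⇒≋ (∑-range-from-2 m _)) (∑-cong-All (upTo m) (upTo-< m) at-part))
    where
    at-part : ∀ j → j < m →
      Sum (compositions (suc m) k) admissible (λ ks → nat (at ks (suc (suc j)) ∸ 1) · g (suc (suc j)) ks)
      ≋ ∑ (upTo k) (λ t → ∑ (compositions (suc m) (k ∸ suc t)) (λ ks →
          when (admissible ks) (g (suc (suc j)) (plusAt (suc (suc j)) (suc t) ks))))
    at-part j j<m = begin
        Sum (compositions (suc m) k) admissible (λ ks → nat (at ks i ∸ 1) · g i ks)
      ≡⟨ Sum-as-∑ (compositions (suc m) k) admissible _ ⟩
        ∑ (compositions (suc m) k) (λ ks → when (admissible ks) (nat (at ks i ∸ 1) · g i ks))
      ≡⟨ ∑-cong≡ (compositions (suc m) k) (λ ks → when-· (admissible ks) (nat (at ks i ∸ 1)) (g i ks)) ⟩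
        ∑ (compositions (suc m) k) (λ ks → nat (at ks i ∸ 1) · admissible-g ks)
      ≈⟨ ∑-compositions-weighted k (suc m) i 0 (s≤s z≤n) (s≤s j<m) admissible-g ⟨
        ∑ (upTo k) (λ t → ∑ (compositions (suc m) (k ∸ suc t)) (λ ks →
          when (1 ≤ᵇ at ks i) (admissible-g (plusAt i (suc t) ks))))
      ≈⟨ ∑-cong (upTo k) (λ t → ∑-cong-All (compositions (suc m) (k ∸ suc t)) (compositions-positive (suc m) (k ∸ suc t))
           λ ks (len , pos) → ≡⇒≋ (positive-part ks t (at-positive i ks (s≤s z≤n) (subst (i ≤_) (sym len) (s≤s j<m)) pos))) ⟩
        ∑ (upTo k) (λ t → ∑ (compositions (suc m) (k ∸ suc t)) (λ ks →
          when (admissible ks) (g i (plusAt i (suc t) ks)))) ∎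
      where
      i = suc (suc j)
      admissible-g : List ℕ → Poly
      admissible-g ks = when (admissible ks) (g i ks)
      positive-part : ∀ ks t → 1 ≤ at ks i →
        when (1 ≤ᵇ at ks i) (admissible-g (plusAt i (suc t) ks)) ≡ when (admissible ks) (g i (plusAt i (suc t) ks))
      positive-part ks t 1≤ksᵢ with at ks i | at-plusAt-head j (suc t) ks
      ... | suc _ | head≡ = cong (λ y → when (2 ≤ᵇ y) (g i (plusAt i (suc t) ks))) head≡

  second-identity : ∀ m k (a : R) (ws : List R) → length ws ≡ suc m →
    let ds = diffs ws in
    Sum (compositions (suc (suc m)) k) (λ lks → 2 ≤ᵇ at lks 2)
        (λ lks → Iinv (word ((at lks 1 , a) ∷ [])) ∗ Iinv (word (zw (drop 1 lks) ws)))
    ≋ Sum (compositions (suc (suc m)) k) (λ ks → 2 ≤ᵇ at ks 2)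
          (λ ks → word (zw ks (a ∷ ds)))
    ⊕ Sum (range 1 (suc m)) always (λ i →
        Sum (compositions (suc (suc m)) k) (λ ks → 2 ≤ᵇ at ks 1)
          (λ ks → word (zw ks (insertAt (suc i) a ds))))
    ⊕ Sum (compositions (suc m) k) (λ ks → 2 ≤ᵇ at ks 1)
          (λ ks → nat (at ks 1 ∸ 2) · word (zw ks (addAt 1 a ds)))
    ⊕ Sum (range 2 (suc m)) always (λ i →
        Sum (compositions (suc m) k) (λ ks → 2 ≤ᵇ at ks 1)
          (λ ks → nat (at ks i ∸ 1) · word (zw ks (addAt i a ds))))
  second-identity m k a ws len = begin
      Sum (compositions (suc (suc m)) k) (λ lks → 2 ≤ᵇ at lks 2) stuffle
    ≡⟨ Sum-as-∑ (compositions (suc (suc m)) k) (λ lks → 2 ≤ᵇ at lks 2) stuffle ⟩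
      ∑ (compositions (suc (suc m)) k) (λ lks → when (2 ≤ᵇ at lks 2) (stuffle lks))
    ≈⟨ ∑-compositions-by-head (suc m) k _ ⟩
      ∑ (upTo k) (λ t → ∑ (tails t) (λ ks → when (admissible ks) (stuffle (suc t ∷ ks))))
    ≈⟨ ∑-cong (upTo k) (λ t → ∑-admissible-Iinv-∗ m (suc t) a ws (tails t) len (compositions-length (suc m) (k ∸ suc t))) ⟩
      ∑ (upTo k) (λ t → E₁ t ⊕ ∑ (upTo (suc m)) (E₂ t) ⊕ (E₃ t ⊕ ∑ (upTo m) (E₄ t)))
    ≈⟨ ∑-⊕⁴ (upTo k) E₁ (λ t → ∑ (upTo (suc m)) (E₂ t)) E₃ (λ t → ∑ (upTo m) (E₄ t)) ⟩
      ∑ (upTo k) E₁ ⊕ ∑ (upTo k) (λ t → ∑ (upTo (suc m)) (E₂ t))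
      ⊕ (∑ (upTo k) E₃ ⊕ ∑ (upTo k) (λ t → ∑ (upTo m) (E₄ t)))
    ≈⟨ ⊕-cong (⊕-cong (∑-leading-part (suc m) k λ ks → word (zw ks (a ∷ ds)))
                      (≋-trans (∑-swap (upTo k) (upTo (suc m)) E₂)
                               (∑-inserted-parts m k λ i ks → word (zw ks (insertAt i a ds)))))
              (⊕-cong (∑-weighted-first m k λ ks → word (zw ks (addAt 1 a ds)))
                      (≋-trans (∑-swap (upTo k) (upTo m) E₄)
                               (∑-weighted-parts m k λ i ks → word (zw ks (addAt i a ds))))) ⟩
      T₁ ⊕ T₂ ⊕ (T₃ ⊕ T₄)
    ≈⟨ ⊕-assoc (T₁ ⊕ T₂) T₃ T₄ ⟨
      T₁ ⊕ T₂ ⊕ T₃ ⊕ T₄ ∎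
    where
    ds = diffs ws
    stuffle : List ℕ → Poly
    stuffle lks = Iinv (word ((at lks 1 , a) ∷ [])) ∗ Iinv (word (zw (drop 1 lks) ws))
    tails : ℕ → List (List ℕ)
    tails t = compositions (suc m) (k ∸ suc t)
    E₁ E₃ : ℕ → Poly
    E₁ t = ∑ (tails t) (λ ks → when (admissible ks) (word ((suc t , a) ∷ zw ks ds)))
    E₃ t = ∑ (tails t) (λ ks → when (admissible ks) (word (zw (plusAt 1 (suc t) ks) (addAt 1 a ds))))
    E₂ E₄ : ℕ → ℕ → Poly
    E₂ t j = ∑ (tails t) (λ ks → when (admissible ks)
               (word (zw (insertAt (suc (suc j)) (suc t) ks) (insertAt (suc (suc j)) a ds))))
    E₄ t j = ∑ (tails t) (λ ks → when (admissible ks)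
               (word (zw (plusAt (suc (suc j)) (suc t) ks) (addAt (suc (suc j)) a ds))))
    T₁ T₂ T₃ T₄ : Poly
    T₁ = Sum (compositions (suc (suc m)) k) (λ ks → 2 ≤ᵇ at ks 2) (λ ks → word (zw ks (a ∷ ds)))
    T₂ = Sum (range 1 (suc m)) always (λ i →
           Sum (compositions (suc (suc m)) k) admissible (λ ks → word (zw ks (insertAt (suc i) a ds))))
    T₃ = Sum (compositions (suc m) k) admissible (λ ks → nat (at ks 1 ∸ 2) · word (zw ks (addAt 1 a ds)))
    T₄ = Sum (range 2 (suc m)) always (λ i →
           Sum (compositions (suc m) k) admissible (λ ks → nat (at ks i ∸ 1) · word (zw ks (addAt i a ds))))

lemma4p1 : (N : ℕ) .{{_ : NonZero N}} (k n : ℕ) → 2 ≤ n → suc n ≤ k →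
    let open Alg N in
    (a : R) (as : Vec R (n ∸ 1)) →
    let ws = toList as
        ds = diffs ws
    in
    -- first identity
    (Sum (compositions (n ∸ 1) (k ∸ 1)) (λ ks → 2 ≤ᵇ at ks 1)
         (λ ks → Iinv (word ((1 , a) ∷ [])) ∗ Iinv (word (zw ks ws)))
     ≈ Sum (compositions (n ∸ 1) (k ∸ 1)) (λ ks → 2 ≤ᵇ at ks 1)
           (λ ks → word ((1 , a) ∷ zw ks ds))
     ⊕ Sum (range 2 n) always (λ i →
         Sum (compositions n k) (λ ks → (2 ≤ᵇ at ks 1) ∧ (at ks i ≡ᵇ 1))
           (λ ks → word (zw ks (insertAt i a ds))))
     ⊕ Sum (compositions (n ∸ 1) k) (λ ks → 3 ≤ᵇ at ks 1)
           (λ ks → word (zw ks (addAt 1 a ds)))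
     ⊕ Sum (range 2 (n ∸ 1)) always (λ i →
         Sum (compositions (n ∸ 1) k) (λ ks → (2 ≤ᵇ at ks 1) ∧ (2 ≤ᵇ at ks i))
           (λ ks → word (zw ks (addAt i a ds)))))
    ×
    -- second identity
    (Sum (compositions n k) (λ lks → 2 ≤ᵇ at lks 2)
         (λ lks → Iinv (word ((at lks 1 , a) ∷ [])) ∗ Iinv (word (zw (drop 1 lks) ws)))
     ≈ Sum (compositions n k) (λ ks → 2 ≤ᵇ at ks 2)
           (λ ks → word (zw ks (a ∷ ds)))
     ⊕ Sum (range 1 (n ∸ 1)) always (λ i →
         Sum (compositions n k) (λ ks → 2 ≤ᵇ at ks 1)
           (λ ks → word (zw ks (insertAt (suc i) a ds))))
     ⊕ Sum (compositions (n ∸ 1) k) (λ ks → 2 ≤ᵇ at ks 1)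
           (λ ks → nat (at ks 1 ∸ 2) · word (zw ks (addAt 1 a ds)))
     ⊕ Sum (range 2 (n ∸ 1)) always (λ i →
         Sum (compositions (n ∸ 1) k) (λ ks → 2 ≤ᵇ at ks 1)
           (λ ks → nat (at ks i ∸ 1) · word (zw ks (addAt i a ds)))))
lemma4p1 N (suc s) (suc (suc m)) (s≤s (s≤s z≤n)) _ a as =
  get (first-identity N m s a (toList as) (Vec.length-toList as)) ,
  get (second-identity N m (suc s) a (toList as) (Vec.length-toList as))
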